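{- Let $\mathbf{R}^{\Rightarrow}$ be a finite coherent set of normality conditionals with LM-sequence $(\mathcal{E}_i)_{i\geq 0}$. Then the sequence is eventually constant and its eventual value $\mathcal{E}_\infty$ is $\emptyset$.
   Context: Formulas are built from propositional letters with the Boolean connectives; a normality conditional is a formula $A\Rightarrow B$ with $A,B$ Boolean, with body $b(A\Rightarrow B)=A$ and head $B$. $\models_{\mathrm{PL}}$ denotes classical propositional consequence. For $X\subseteq\mathbf{R}^{\Rightarrow}$, $\mathrm{m}(X)=\{B\rightarrow C : B\Rightarrow C\in X\}$ and $\varepsilon(X)=\{A\Rightarrow B\in\mathbf{R}^{\Rightarrow} : \mathrm{m}(X)\models_{\mathrm{PL}}\neg A\}$. The LM-sequence is $\mathcal{E}_0=\mathbf{R}^{\Rightarrow}$, $\mathcal{E}_i=\varepsilon(\mathcal{E}_{i-1})$ for $i\geq 1$; its order $m$ is the least $k$ such that $\mathcal{E}_l=\mathcal{E}_k$ for all $l>k$, and $\mathcal{E}_\infty=\mathcal{E}_m$. $\mathbf{R}^{\Rightarrow}$ is coherent if there is no nonempty $X\subseteq\mathbf{R}^{\Rightarrow}$ with $\mathrm{m}(X)\models_{\mathrm{PL}}\bigwedge_{r\in X}\neg b(r)$ (standing assumption of the paper). -}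

module Defs where

open import Data.Nat using (ℕ; zero; suc; _<_; _≥_)
open import Data.Bool using (Bool; true; false; not; _∧_; _∨_)
open import Data.Product using (_×_; _,_; proj₁; proj₂; ∃)
open import Data.List using (List)
open import Data.List.Membership.Propositional using (_∈_)
open import Relation.Binary.PropositionalEquality using (_≡_)
open import Relation.Nullary using (¬_)
open import Level using (Level) renaming (suc to lsuc; zero to lzero)

data Formula : Set where
  var  : ℕ → Formula
  ⊤f ⊥f : Formula
  ¬f_  : Formula → Formula
  _∧f_ _∨f_ _⇒f_ : Formula → Formula → Formula

Valuation : Set
Valuation = ℕ → Bool

eval : Valuation → Formula → Bool
eval v (var p)   = v p
eval v ⊤f        = true
eval v ⊥f        = false
eval v (¬f a)    = not (eval v a)
eval v (a ∧f b)  = eval v a ∧ eval v b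
eval v (a ∨f b)  = eval v a ∨ eval v b
eval v (a ⇒f b)  = not (eval v a) ∨ eval v b

_⊨_ : Valuation → Formula → Set
v ⊨ a = eval v a ≡ true

-- normality conditional A ⇒ B, represented as the pair (A , B)
Cond : Set
Cond = Formula × Formula

body : Cond → Formula
body = proj₁

head : Cond → Formula
head = proj₂

mat : Cond → Formula
mat (b , c) = b ⇒f c

CondSet : Set₁
CondSet = Cond → Set

_m⊨_ : CondSet → Formula → Set
X m⊨ φ = (v : Valuation) → (∀ s → X s → v ⊨ mat s) → v ⊨ φ

_m⊨all¬body : CondSet → Set
X m⊨all¬body = (v : Valuation) → (∀ s → X s → v ⊨ mat s) → ∀ r → X r → v ⊨ (¬f body r)

ε : List Cond → CondSet → CondSet
ε R X r = (r ∈ R) × (X m⊨ (¬f body r))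

LM : List Cond → ℕ → CondSet
LM R zero    r = r ∈ R
LM R (suc i) = ε R (LM R i)

_≐_ : CondSet → CondSet → Set
X ≐ Y = ∀ r → (X r → Y r) × (Y r → X r)

Coherent : List Cond → Set₁
Coherent R = (X : CondSet) → (∀ r → X r → r ∈ R) → ∃ X → ¬ (X m⊨all¬body)

StableFrom : List Cond → ℕ → Set
StableFrom R k = ∀ l → l ≥ k → LM R l ≐ LM R k

IsOrder : List Cond → ℕ → Set
IsOrder R m = StableFrom R m × (∀ k → k < m → ¬ StableFrom R k)

Empty : CondSet → Set
Empty X = ∀ r → ¬ X r

{-# OPTIONS --safe #-}
-- Since ε is monotone, the LM-sequence is decreasing. A set E ⊆ R with
-- E ⊆ ε(E) has m(E) refuting every body in E, which coherence allows only
-- for E = ∅; so each Eᵢ ≠ ∅ is strictly larger than Eᵢ₊₁, and once the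
-- sequence reaches ∅ it stays there. The order is therefore the first i with
-- Eᵢ = ∅. Finding it constructively needs each Eᵢ to be decidable: entailment
-- from a finite set is decided by truth tables, and Eᵢ is computed as a list.
module Submission where

open import Defs
open import Data.List using (List)
open import Data.Product using (Σ; _×_)
open import Data.Nat using (ℕ)

open import Data.Bool using (Bool; true; false; not; _∧_; _∨_)
import Data.Bool.Properties as Bool
open import Data.Empty using (⊥-elim)
open import Data.List using ([]; _∷_; length; filter)
open import Data.List.Membership.Propositional using (_∈_; _∉_)
open import Data.List.Membership.Propositional.Properties using (∈-filter⁺; ∈-filter⁻)
open import Data.List.Properties using (filter-notAll)
open import Data.List.Relation.Unary.All as All using (All)
open import Data.List.Relation.Unary.All.Properties using (¬All⇒Any¬)
open import Data.List.Relation.Unary.Any using (here; there)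
open import Data.Nat using (zero; suc; _≤_; _<_; _≤′_; ≤′-refl; ≤′-step; _⊔_; s≤s; _≟_)
open import Data.Nat.Properties
  using (≤-refl; ≤-trans; ≤-pred; <-≤-trans; n≤0⇒n≡0; n≤1+n; m≤n⇒m<n∨m≡n; ≤⇒≤′; m≤m⊔n; m≤n⊔m)
open import Data.Product using (_,_; proj₁; proj₂; Σ-syntax)
open import Data.Sum using (inj₁; inj₂)
open import Function using (_∘_)
open import Relation.Binary.Definitions using (_Respects_)
open import Relation.Binary.PropositionalEquality using (_≡_; _≢_; refl; sym; trans; cong; cong₂)
open import Relation.Nullary using (Dec; yes; no; ¬_)
open import Relation.Nullary.Decidable using (map′; _×-dec_)
open import Relation.Unary using (Decidable; _⊆_)

least-zero : (c : ℕ → ℕ) → (∀ i → c i ≢ 0 → c (suc i) < c i) →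
             Σ[ m ∈ ℕ ] c m ≡ 0 × (∀ k → k < m → c k ≢ 0)
least-zero c shrinks = search (c 0) 0 ≤-refl (λ _ ())
  where
  search : ∀ n j → c j ≤ n → (∀ k → k < j → c k ≢ 0) →
           Σ[ m ∈ ℕ ] c m ≡ 0 × (∀ k → k < m → c k ≢ 0)
  search n j cj≤n below with c j ≟ 0
  ... | yes cj≡0 = j , cj≡0 , below
  search zero    j cj≤0   below | no cj≢0 = ⊥-elim (cj≢0 (n≤0⇒n≡0 cj≤0))
  search (suc n) j cj≤1+n below | no cj≢0 =
    search n (suc j) (≤-pred (≤-trans (shrinks j cj≢0) cj≤1+n)) below′
    where
    below′ : ∀ k → k < suc j → c k ≢ 0
    below′ k k<1+j with m≤n⇒m<n∨m≡n (≤-pred k<1+j)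
    ... | inj₁ k<j  = below k k<j
    ... | inj₂ refl = cj≢0

length≡0⇒∉ : ∀ {A : Set} {L : List A} {x : A} → length L ≡ 0 → x ∉ L
length≡0⇒∉ {L = []}    _ ()
length≡0⇒∉ {L = _ ∷ _} ()

∉⇒length≡0 : ∀ {A : Set} (L : List A) → (∀ x → x ∉ L) → length L ≡ 0
∉⇒length≡0 []      _   = refl
∉⇒length≡0 (x ∷ _) ∉L = ⊥-elim (∉L x (here refl))

bound : Formula → ℕ
bound (var p)  = suc p
bound ⊤f       = 0
bound ⊥f       = 0
bound (¬f a)   = bound a
bound (a ∧f b) = bound a ⊔ bound b
bound (a ∨f b) = bound a ⊔ bound b
bound (a ⇒f b) = bound a ⊔ bound b

Agree : ℕ → Valuation → Valuation → Set
Agree n v w = ∀ p → p < n → v p ≡ w p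

agree-≤ : ∀ {m n v w} → m ≤ n → Agree n v w → Agree m v w
agree-≤ m≤n agree p p<m = agree p (<-≤-trans p<m m≤n)

eval-local : ∀ φ {v w} → Agree (bound φ) v w → eval v φ ≡ eval w φ
eval-local (var p)  agree = agree p ≤-refl
eval-local ⊤f       agree = refl
eval-local ⊥f       agree = refl
eval-local (¬f a)   agree = cong not (eval-local a agree)
eval-local (a ∧f b) agree = cong₂ _∧_
  (eval-local a (agree-≤ (m≤m⊔n _ _) agree)) (eval-local b (agree-≤ (m≤n⊔m _ _) agree))
eval-local (a ∨f b) agree = cong₂ _∨_
  (eval-local a (agree-≤ (m≤m⊔n _ _) agree)) (eval-local b (agree-≤ (m≤n⊔m _ _) agree))
eval-local (a ⇒f b) agree = cong₂ (λ x y → not x ∨ y)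
  (eval-local a (agree-≤ (m≤m⊔n _ _) agree)) (eval-local b (agree-≤ (m≤n⊔m _ _) agree))

_◂_ : Bool → Valuation → Valuation
(b ◂ v) zero    = b
(b ◂ v) (suc p) = v p

◂-agree : ∀ {n v w} b → Agree n v w → Agree (suc n) (b ◂ v) (b ◂ w)
◂-agree b agree zero    _         = refl
◂-agree b agree (suc p) (s≤s p<n) = agree p p<n

◂-η : ∀ v p → (v zero ◂ (v ∘ suc)) p ≡ v p
◂-η v zero    = refl
◂-η v (suc p) = refl

-- Splitting on the value of letter 0 and shifting the others down reduces
-- a quantifier over valuations supported below n + 1 to one below n.
∀-valuation? : ∀ n {P : Valuation → Set} → P Respects Agree n → Decidable P → Dec (∀ v → P v)
∀-valuation? zero    resp P? = map′ (λ p v → resp (λ _ ()) p) (λ all → all _) (P? (λ _ → false))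
∀-valuation? (suc n) {P} resp P? =
  map′ (λ all v → resp (λ p _ → ◂-η v p) (both (v zero) (all (v ∘ suc))))
       (λ all v → all (true ◂ v) , all (false ◂ v))
       (∀-valuation? n both-resp (λ v → P? (true ◂ v) ×-dec P? (false ◂ v)))
  where
  both : ∀ b {v} → P (true ◂ v) × P (false ◂ v) → P (b ◂ v)
  both true  = proj₁
  both false = proj₂

  both-resp : ∀ {v w} → Agree n v w → P (true ◂ v) × P (false ◂ v) → P (true ◂ w) × P (false ◂ w)
  both-resp agree (pt , pf) = resp (◂-agree true agree) pt , resp (◂-agree false agree) pf

valid? : ∀ φ → Dec (∀ v → v ⊨ φ)
valid? φ = ∀-valuation? (bound φ) (λ agree v⊨φ → trans (sym (eval-local φ agree)) v⊨φ)
                        (λ v → eval v φ Bool.≟ true)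

⊨⇒f⁺ : ∀ {v} a b → (v ⊨ a → v ⊨ b) → v ⊨ (a ⇒f b)
⊨⇒f⁺ {v} a b imp with eval v a
... | false = refl
... | true  = imp refl

⊨⇒f⁻ : ∀ {v} a b → v ⊨ (a ⇒f b) → v ⊨ a → v ⊨ b
⊨⇒f⁻ a b imp v⊨a rewrite v⊨a = imp

⋀mat : List Cond → Formula
⋀mat []      = ⊤f
⋀mat (s ∷ L) = mat s ∧f ⋀mat L

⊨⋀mat⁺ : ∀ {v} L → (∀ s → s ∈ L → v ⊨ mat s) → v ⊨ ⋀mat L
⊨⋀mat⁺ []      _   = refl
⊨⋀mat⁺ (s ∷ L) ⊨L rewrite ⊨L s (here refl) = ⊨⋀mat⁺ L (λ s′ → ⊨L s′ ∘ there)

⊨⋀mat⁻ : ∀ {v} L → v ⊨ ⋀mat L → ∀ s → s ∈ L → v ⊨ mat s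
⊨⋀mat⁻ (s ∷ L) ⊨⋀ s  (here refl)  = Bool.∧-conicalˡ _ _ ⊨⋀
⊨⋀mat⁻ (s ∷ L) ⊨⋀ s′ (there s′∈L) = ⊨⋀mat⁻ L (Bool.∧-conicalʳ _ _ ⊨⋀) s′ s′∈L

m⊨? : ∀ L φ → Dec ((_∈ L) m⊨ φ)
m⊨? L φ = map′ (λ valid v ⊨L → ⊨⇒f⁻ (⋀mat L) φ (valid v) (⊨⋀mat⁺ L ⊨L))
               (λ ent v → ⊨⇒f⁺ (⋀mat L) φ (ent v ∘ ⊨⋀mat⁻ L))
               (valid? (⋀mat L ⇒f φ))

refutes-body? : ∀ L → Decidable (λ r → (_∈ L) m⊨ (¬f body r))
refutes-body? L r = m⊨? L (¬f body r)

m⊨-mono : ∀ {X Y : CondSet} φ → X ⊆ Y → X m⊨ φ → Y m⊨ φ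
m⊨-mono _ X⊆Y ent v ⊨Y = ent v (λ s → ⊨Y s ∘ X⊆Y)

ε-mono : ∀ {R} {X Y : CondSet} → X ⊆ Y → ε R X ⊆ ε R Y
ε-mono X⊆Y {r} (r∈R , ent) = r∈R , m⊨-mono (¬f body r) X⊆Y ent

coherent-⊆ε⇒Empty : ∀ {R} → Coherent R → ∀ {X : CondSet} → (∀ r → X r → r ∈ R) → X ⊆ ε R X → Empty X
coherent-⊆ε⇒Empty coh X⊆R X⊆εX r x = coh _ X⊆R (r , x) (λ v ⊨X _ x′ → proj₂ (X⊆εX x′) v ⊨X)

Empty⇒≐ : ∀ {X Y : CondSet} → Empty X → Empty Y → X ≐ Y
Empty⇒≐ ∅X ∅Y r = ⊥-elim ∘ ∅X r , ⊥-elim ∘ ∅Y r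

module _ (R : List Cond) where

  LM⊆R : ∀ i r → LM R i r → r ∈ R
  LM⊆R zero    _ r∈R = r∈R
  LM⊆R (suc i) _     = proj₁

  LM-suc⊆ : ∀ i → LM R (suc i) ⊆ LM R i
  LM-suc⊆ zero    = proj₁
  LM-suc⊆ (suc i) = ε-mono (LM-suc⊆ i)

  LM-antitone : ∀ {k l} → k ≤′ l → LM R l ⊆ LM R k
  LM-antitone ≤′-refl = λ x → x
  LM-antitone {l = suc l} (≤′-step k≤′l) = LM-antitone k≤′l ∘ LM-suc⊆ l

  StableFrom⇒Empty : Coherent R → ∀ k → StableFrom R k → Empty (LM R k)
  StableFrom⇒Empty coh k stable =
    coherent-⊆ε⇒Empty coh (LM⊆R k) (proj₂ (stable (suc k) (n≤1+n k) _))

  -- Filtering the previous layer instead of R gives the same set (LM is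
  -- decreasing) and makes shrinking a statement about filter lengths.
  layer : ℕ → List Cond
  layer zero    = R
  layer (suc i) = filter (refutes-body? (layer i)) (layer i)

  ∈-layer⁻ : ∀ i → (_∈ layer i) ⊆ LM R i
  ∈-layer⁻ zero    r∈R = r∈R
  ∈-layer⁻ (suc i) {r} r∈ with ∈-filter⁻ (refutes-body? (layer i)) r∈
  ... | r∈layer , ent = LM⊆R i _ (∈-layer⁻ i r∈layer) , m⊨-mono (¬f body r) (∈-layer⁻ i) ent

  ∈-layer⁺ : ∀ i → LM R i ⊆ (_∈ layer i)
  ∈-layer⁺ zero    r∈R = r∈R
  ∈-layer⁺ (suc i) {r} x = ∈-filter⁺ (refutes-body? (layer i))
    (∈-layer⁺ i (LM-suc⊆ i x)) (m⊨-mono (¬f body r) (∈-layer⁺ i) (proj₂ x))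

  Empty⇒length≡0 : ∀ i → Empty (LM R i) → length (layer i) ≡ 0
  Empty⇒length≡0 i ∅ = ∉⇒length≡0 (layer i) (λ r → ∅ r ∘ ∈-layer⁻ i)

  length≡0⇒Empty : ∀ i → length (layer i) ≡ 0 → Empty (LM R i)
  length≡0⇒Empty i len≡0 r = length≡0⇒∉ len≡0 ∘ ∈-layer⁺ i

  layer-shrinks : Coherent R → ∀ i → length (layer i) ≢ 0 → length (layer (suc i)) < length (layer i)
  layer-shrinks coh i len≢0 =
    filter-notAll (refutes-body? (layer i)) (layer i)
      (¬All⇒Any¬ (refutes-body? (layer i)) (layer i) (len≢0 ∘ Empty⇒length≡0 i ∘ all-refuted⇒Empty))
    where
    all-refuted⇒Empty : All (λ r → (_∈ layer i) m⊨ (¬f body r)) (layer i) → Empty (LM R i)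
    all-refuted⇒Empty all = coherent-⊆ε⇒Empty coh (LM⊆R i) λ {r} x →
      LM⊆R i _ x , m⊨-mono (¬f body r) (∈-layer⁻ i) (All.lookup all (∈-layer⁺ i x))

fact2 : (R : List Cond) → Coherent R → Σ ℕ (λ m → IsOrder R m × Empty (LM R m))
fact2 R coh with least-zero (length ∘ layer R) (layer-shrinks R coh)
... | m , len≡0 , len≢0-before = m , (stable , minimal) , ∅m
  where
  ∅m : Empty (LM R m)
  ∅m = length≡0⇒Empty R m len≡0

  stable : StableFrom R m
  stable l m≤l = Empty⇒≐ (λ r → ∅m r ∘ LM-antitone R (≤⇒≤′ m≤l)) ∅m

  minimal : ∀ k → k < m → ¬ StableFrom R k
  minimal k k<m = len≢0-before k k<m ∘ Empty⇒length≡0 R k ∘ StableFrom⇒Empty R coh k
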